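{- Let $n$ be a positive integer and let $x$ be a positive integer with $x\equiv 0\pmod{n!}$. Then $x+\frac{1}{n}$ is a cutoff.
   Context: For a real number $\alpha\ge 1$, define the integer sequence $(P^\alpha_i)_{i\ge 0}$ by $P^\alpha_0=0$, $P^\alpha_1=1$, and for $k\ge 1$, $P^\alpha_{k+1}=P^\alpha_k+P^\alpha_j$, where $j$ is the unique index with $\alpha P^\alpha_{j-1}<P^\alpha_k\le \alpha P^\alpha_j$. A cutoff is a real number $\alpha\ge 1$ such that for every real $\beta$ with $1\le\beta<\alpha$, the sequences $(P^\alpha_i)$ and $(P^\beta_i)$ are not identical. -}

module Defs where

open import Data.Bool using (Bool; true; false; if_then_else_)
open import Data.Nat as ℕ using (ℕ; zero; suc; _+_)
open import Data.Integer using (+_)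
open import Data.Rational using (ℚ; _/_; _≤_; _<_; _≤ᵇ_; 1ℚ)
open import Data.List using (List; []; _∷_; _++_)
open import Data.Product using (_×_; _,_; proj₁; proj₂; ∃)
open import Relation.Binary.PropositionalEquality using (_≡_)
open import Relation.Nullary using (¬_)

-- A real number β is represented (classically faithfully) by its
-- lower Dedekind cut as a Boolean predicate: c q ≡ true  iff  q ≤ β.
record IsRealCut (c : ℚ → Bool) : Set where
  field
    downward : ∀ q r → q ≤ r → c r ≡ true → c q ≡ true
    inhabited : ∃ λ q → c q ≡ true
    bounded  : ∃ λ r → c r ≡ false
    -- the cut {q | q ≤ β} contains its supremum
    closed   : ∀ r → (∀ q → q < r → c q ≡ true) → c r ≡ true

ratCut : ℚ → ℚ → Bool
ratCut α q = q ≤ᵇ α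

-- leCut c a b  decides  a ≤ β·b  (for b > 0; b = 0 never occurs as P_j, j ≥ 1)
leCut : (ℚ → Bool) → ℕ → ℕ → Bool
leCut c a zero = false
leCut c a (suc b) = c (+ a / suc b)

find : (ℕ → ℕ → Bool) → ℕ → List ℕ → ℕ
find le p [] = 0
find le p (y ∷ ys) = if le p y then y else find le p ys

-- state i = ([P_1, …, P_k], P_k) with k = i + 1
state : (ℕ → ℕ → Bool) → ℕ → List ℕ × ℕ
state le zero = (1 ∷ [] , 1)
state le (suc i) =
  let L = proj₁ (state le i)
      p = proj₂ (state le i)
      q = p + find le p L
  in (L ++ (q ∷ []) , q)

P : (ℚ → Bool) → ℕ → ℕ
P c zero = 0
P c (suc i) = proj₂ (state (leCut c) i)

IsCutoff : ℚ → Set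
IsCutoff α = (1ℚ ≤ α) ×
  ((c : ℚ → Bool) → IsRealCut c → c 1ℚ ≡ true → c α ≡ false →
     ¬ (∀ i → P c i ≡ P (ratCut α) i))

module Submission where

-- We compute
-- an initial segment of the α-sequence explicitly and find a step at which α
-- is tight, so that no β < α can reproduce it.
--
--  * For i ≤ x the sequence is P_{i+1} = i + 1 (each step adds P_1 = 1, since
--    P ≤ x + 1 ≤ α).  Hence P_j = j for every index j ≤ x + 1.
--  * For m = 1, …, N - 1 the values x·m + 1 + (m + 1)·t, 0 ≤ t ≤ x/(m+1),
--    occur consecutively: α·m < P ≤ α·(m + 1), so every step adds m + 1.
--    Since (m + 1) ∣ x the phase ends exactly at x·(m + 1) + 1.
--  * After the last phase P = xN + 1 = α·N, so the next step adds P_N = N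
--    precisely because xN + 1 ≤ α·N holds with equality.  A cut c of a real
--    β producing the same sequence must therefore satisfy αN ≤ βN, i.e. β ≥ α.

open import Defs
open import Data.Nat using (ℕ; NonZero; _*_; _+_; _<_; _!)
open import Data.Nat.Divisibility using (_∣_)
open import Data.Integer using (+_)
open import Data.Rational using (_/_)

open import Data.Nat as ℕ using (zero; suc; z≤n; s≤s; _≤_)
open import Data.Nat.Properties
open import Data.Nat.Divisibility using (divides; ∣⇒≤; ∣-trans; m∣m*n; m≤n⇒m!∣n!)
open import Data.Nat.Tactic.RingSolver using (solve-∀)
import Data.Integer as ℤ
import Data.Integer.Properties as ℤ
open import Data.Rational as ℚ using (ℚ; toℚᵘ; 1ℚ)
open import Data.Rational.Properties as ℚ using (toℚᵘ-mono-≤; toℚᵘ-cancel-≤; toℚᵘ-fromℚᵘ)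
import Data.Rational.Unnormalised as ℚᵘ
import Data.Rational.Unnormalised.Properties as ℚᵘ
open import Data.Bool using (Bool; true; false; T)
open import Data.Bool.Properties using (T-≡)
open import Function.Bundles using (Equivalence)
open import Data.List using (List; []; _∷_; _++_)
open import Data.List.Properties using (++-assoc; ++-identityʳ)
open import Data.Product using (_,_; proj₁; proj₂; Σ)
open import Data.Sum using (inj₁; inj₂)
open import Relation.Nullary using (¬_; contradiction)
open import Relation.Binary.PropositionalEquality

∣-factorial : ∀ {k n} → k ≤ n → suc k ∣ suc n !
∣-factorial {k} k≤n = ∣-trans (m∣m*n (k !)) (m≤n⇒m!∣n! (s≤s k≤n))

fraction-as-ℚᵘ : ∀ a b → toℚᵘ (+ a / suc b) ℚᵘ.≃ ℚᵘ.mkℚᵘ (+ a) b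
fraction-as-ℚᵘ a b = toℚᵘ-fromℚᵘ (ℚᵘ.mkℚᵘ (+ a) b)

fraction-≤⇒ : ∀ a b c d → (+ a / suc b) ℚ.≤ (+ c / suc d) → a * suc d ≤ c * suc b
fraction-≤⇒ a b c d p
  with ℚᵘ.≤-respʳ-≃ (fraction-as-ℚᵘ c d) (ℚᵘ.≤-respˡ-≃ (fraction-as-ℚᵘ a b) (toℚᵘ-mono-≤ p))
... | ℚᵘ.*≤* q = ℤ.drop‿+≤+ (subst₂ ℤ._≤_ (sym (ℤ.pos-* a (suc d))) (sym (ℤ.pos-* c (suc b))) q)

fraction-≤⇐ : ∀ a b c d → a * suc d ≤ c * suc b → (+ a / suc b) ℚ.≤ (+ c / suc d)
fraction-≤⇐ a b c d q =
  toℚᵘ-cancel-≤ (ℚᵘ.≤-respʳ-≃ (ℚᵘ.≃-sym (fraction-as-ℚᵘ c d))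
                (ℚᵘ.≤-respˡ-≃ (ℚᵘ.≃-sym (fraction-as-ℚᵘ a b))
                  (ℚᵘ.*≤* (subst₂ ℤ._≤_ (ℤ.pos-* a (suc d)) (ℤ.pos-* c (suc b)) (ℤ.+≤+ q)))))

interval : ℕ → ℕ → List ℕ
interval a zero = []
interval a (suc k) = a ∷ interval (suc a) k

interval-snoc : ∀ a k → interval a k ++ (a + k ∷ []) ≡ interval a (suc k)
interval-snoc a zero = cong (_∷ []) (+-identityʳ a)
interval-snoc a (suc k) =
  cong (a ∷_) (trans (cong (λ z → interval (suc a) k ++ (z ∷ [])) (+-suc a k))
                     (interval-snoc (suc a) k))

find-interval : ∀ (le : ℕ → ℕ → Bool) p k a R m → a ≤ m → m < a + k →
  (∀ y → y < m → le p y ≡ false) → le p m ≡ true →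
  find le p (interval a k ++ R) ≡ m
find-interval le p zero a R m a≤m m<a+0 miss hit =
  contradiction (subst (_≤ m) (sym (+-identityʳ a)) a≤m) (<⇒≱ m<a+0)
find-interval le p (suc k) a R m a≤m m<a+k miss hit with m≤n⇒m<n∨m≡n a≤m
... | inj₂ refl rewrite hit = refl
... | inj₁ a<m rewrite miss a a<m =
  find-interval le p k (suc a) R m a<m (subst (m <_) (+-suc a k) m<a+k) miss hit

find-found : ∀ le p L y → find le p L ≡ suc y → le p (suc y) ≡ true
find-found le p [] y ()
find-found le p (z ∷ L) y found with le p z in accepted
... | true = subst (λ w → le p w ≡ true) found accepted
... | false = find-found le p L y found

state-next : ∀ le {i L p j} → state le i ≡ (L , p) → find le p L ≡ j →
  state le (suc i) ≡ (L ++ (p + j ∷ []) , p + j)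
state-next le st refl rewrite st = refl

same-P⇒same-state : ∀ c c' → (∀ i → P c i ≡ P c' i) →
  ∀ i → state (leCut c) i ≡ state (leCut c') i
same-P⇒same-state c c' same zero = refl
same-P⇒same-state c c' same (suc i) =
  cong₂ (λ L q → (L ++ (q ∷ []) , q))
        (cong proj₁ (same-P⇒same-state c c' same i)) (same (suc (suc i)))

-- Polynomial identities behind the inequalities of a phase with step m + 1,
-- written with N = m + e + 1 and the current value p = xm + 1 + (m+1)t.

lower-gap : ∀ x m t e →
  (x * m + 1 + suc m * t) * suc (m + e) ≡ suc ((x * suc (m + e) + 1) * m + (e + suc m * t * suc (m + e)))
lower-gap = solve-∀

upper-gap : ∀ x m t d e → x ≡ suc (t + d) * suc m →
  (x * suc (m + e) + 1) * suc m ≡ (x * m + 1 + suc m * t) * suc (m + e) + ((m + suc m * d) * suc (m + e) + suc m)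
upper-gap .(suc (t + d) * suc m) m t d e refl = identity m t d e
  where
  identity : ∀ m t d e →
    (suc (t + d) * suc m * suc (m + e) + 1) * suc m
      ≡ (suc (t + d) * suc m * m + 1 + suc m * t) * suc (m + e) + ((m + suc m * d) * suc (m + e) + suc m)
  identity = solve-∀

step-lower : ∀ x m t e N → suc (m + e) ≡ N → (x * N + 1) * m < (x * m + 1 + suc m * t) * N
step-lower x m t e .(suc (m + e)) refl =
  subst (suc ((x * suc (m + e) + 1) * m) ≤_) (sym (lower-gap x m t e)) (s≤s (m≤m+n _ _))

-- p ≤ α·(m+1), as long as the phase has not ended (x = (t+1+d)(m+1)).
step-upper : ∀ x m t d e N → suc (m + e) ≡ N → x ≡ suc (t + d) * suc m →
  (x * m + 1 + suc m * t) * N ≤ (x * N + 1) * suc m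
step-upper x m t d e .(suc (m + e)) refl x≡ =
  subst ((x * m + 1 + suc m * t) * suc (m + e) ≤_) (sym (upper-gap x m t d e x≡)) (m≤m+n _ _)

step-value : ∀ x m t → x * m + 1 + suc m * t + suc m ≡ x * m + 1 + suc m * suc t
step-value = solve-∀

phase-end : ∀ x w m → x ≡ w * suc m → x * m + 1 + suc m * w ≡ x * suc m + 1
phase-end .(w * suc m) w m refl = identity w m
  where
  identity : ∀ w m → w * suc m * m + 1 + suc m * w ≡ w * suc m * suc m + 1
  identity = solve-∀

module AlphaSequence (n' x' : ℕ) where
  N x A : ℕ
  N = suc n'
  x = suc x'
  A = x * N + 1

  α : ℚ
  α = + A / N

  le : ℕ → ℕ → Bool
  le = leCut (ratCut α)

  le-true : ∀ p y → p * N ≤ A * suc y → le p (suc y) ≡ true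
  le-true p y h = Equivalence.to T-≡ (ℚ.≤⇒≤ᵇ (fraction-≤⇐ p y A n' h))

  le-false : ∀ p y → A * y < p * N → le p y ≡ false
  le-false p zero h = refl
  le-false p (suc y) h = ¬T⇒≡false (λ accepted → <⇒≱ h (fraction-≤⇒ p y A n' (ℚ.≤ᵇ⇒≤ accepted)))
    where
    ¬T⇒≡false : ∀ {b} → ¬ T b → b ≡ false
    ¬T⇒≡false {false} _ = refl
    ¬T⇒≡false {true} refuted = contradiction _ refuted

  find-α : ∀ k R p m → m < k → A * m < p * N → p * N ≤ A * suc m →
    find le p (interval 1 k ++ R) ≡ suc m
  find-α k R p m m<k below above =
    find-interval le p k 1 R (suc m) (s≤s z≤n) (s≤s m<k)
      (λ y y≤m → le-false p y (≤-<-trans (*-monoʳ-≤ A (≤-pred y≤m)) below))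
      (le-true p m above)

  initial : ∀ i → i ≤ x → state le i ≡ (interval 1 (suc i) , suc i)
  initial zero _ = refl
  initial (suc i) i<x = begin
      state le (suc i)
    ≡⟨ state-next le (initial i (<⇒≤ i<x)) index-one ⟩
      (interval 1 (suc i) ++ (suc i + 1 ∷ []) , suc i + 1)
    ≡⟨ cong (λ q → (interval 1 (suc i) ++ (q ∷ []) , q)) (+-comm (suc i) 1) ⟩
      (interval 1 (suc i) ++ (1 + suc i ∷ []) , suc (suc i))
    ≡⟨ cong (_, suc (suc i)) (interval-snoc 1 (suc i)) ⟩
      (interval 1 (suc (suc i)) , suc (suc i))
    ∎
    where
    open ≡-Reasoning
    -- 0 < i + 1 ≤ α, so the step is P_1 = 1
    index-one : find le (suc i) (interval 1 (suc i)) ≡ 1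
    index-one = subst (λ L → find le (suc i) L ≡ 1) (++-identityʳ (interval 1 (suc i)))
      (find-α (suc i) [] (suc i) 0 (s≤s z≤n)
        (subst (_< suc i * N) (sym (*-zeroʳ A)) (s≤s z≤n))
        (subst (suc i * N ≤_) (sym (*-identityʳ A)) (≤-trans (*-monoˡ-≤ N i<x) (m≤m+n (x * N) 1))))

  -- After the first phase the list of values always starts with 1, …, x + 1;
  -- Reached p says that the value p occurs in the sequence past that point.
  prefix : List ℕ
  prefix = interval 1 (suc x)

  Reached : ℕ → Set
  Reached p = Σ ℕ λ i → Σ (List ℕ) λ R → state le i ≡ (prefix ++ R , p)

  advance : ∀ {p} m → m < suc x → A * m < p * N → p * N ≤ A * suc m →
    Reached p → Reached (p + suc m)
  advance {p} m m<1+x below above (i , R , st) =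
    suc i , R ++ (p + suc m ∷ []) ,
    trans (state-next le st (find-α (suc x) R p m m<1+x below above))
          (cong (_, p + suc m) (++-assoc prefix R (p + suc m ∷ [])))

  phase : ∀ m e w → m + e ≡ n' → x ≡ w * suc m → Reached (x * m + 1) →
    ∀ t → t ≤ w → Reached (x * m + 1 + suc m * t)
  phase m e w m+e≡n' x≡ start zero _ =
    subst Reached (sym (trans (cong (_+_ (x * m + 1)) (*-zeroʳ (suc m))) (+-identityʳ _))) start
  phase m e w m+e≡n' x≡ start (suc t) t<w =
    subst Reached (step-value x m t)
      (advance m m<1+x
        (step-lower x m t e N (cong suc m+e≡n'))
        (step-upper x m t d e N (cong suc m+e≡n') (trans x≡ (cong (_* suc m) (sym w≡))))
        (phase m e w m+e≡n' x≡ start t (<⇒≤ t<w)))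
    where
    d = proj₁ (m≤n⇒∃[o]m+o≡n t<w)
    w≡ : suc t + d ≡ w
    w≡ = proj₂ (m≤n⇒∃[o]m+o≡n t<w)
    m<1+x : m < suc x
    m<1+x = s≤s (<⇒≤ (∣⇒≤ (divides w x≡)))

  reach : N ! ∣ x → ∀ m → m ≤ n' → Reached (x * suc m + 1)
  reach N!∣x zero _ =
    x , [] , trans (initial x ≤-refl)
      (cong₂ _,_ (sym (++-identityʳ prefix)) (trans (+-comm 1 x) (cong (_+ 1) (sym (*-identityʳ x)))))
  reach N!∣x (suc m) m<n' with ∣-trans (∣-factorial m<n') N!∣x
  ... | divides w x≡ =
    subst Reached (phase-end x w (suc m) x≡)
      (phase (suc m) e w m+e≡n' x≡ (reach N!∣x m (<⇒≤ m<n')) w ≤-refl)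
    where
    e = proj₁ (m≤n⇒∃[o]m+o≡n m<n')
    m+e≡n' : suc m + e ≡ n'
    m+e≡n' = proj₂ (m≤n⇒∃[o]m+o≡n m<n')

  -- At the value A = α·N the next step is P_N = N, since A ≤ α·N is tight.
  -- Any cut c generating the same sequence must therefore accept α.
  same-sequence⇒accepts-α : N ! ∣ x → (c : ℚ → Bool) →
    (∀ i → P c i ≡ P (ratCut α) i) → c α ≡ true
  same-sequence⇒accepts-α N!∣x c same with reach N!∣x n' ≤-refl
  ... | i , R , st = find-found (leCut c) A (prefix ++ R) n' index-for-c
    where
    agree : ∀ j → state (leCut c) j ≡ state le j
    agree = same-P⇒same-state c (ratCut α) same

    N≤x : N ≤ x
    N≤x = ∣⇒≤ (∣-trans (∣-factorial ≤-refl) N!∣x)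

    index-for-α : find le A (prefix ++ R) ≡ N
    index-for-α = find-α (suc x) R A n' (m<n⇒m<1+n N≤x) (*-monoʳ-< A ≤-refl) ≤-refl

    index-for-c : find (leCut c) A (prefix ++ R) ≡ N
    index-for-c = +-cancelˡ-≡ A _ _ (begin
        A + find (leCut c) A (prefix ++ R)
      ≡⟨ cong proj₂ (state-next (leCut c) (trans (agree i) st) refl) ⟨
        proj₂ (state (leCut c) (suc i))
      ≡⟨ cong proj₂ (agree (suc i)) ⟩
        proj₂ (state le (suc i))
      ≡⟨ cong proj₂ (state-next le st index-for-α) ⟩
        A + N
      ∎)
      where open ≡-Reasoning

theorem6p10 : (n x : ℕ) → .{{_ : NonZero n}} → 0 < x → (n !) ∣ x →
    IsCutoff (+ (x * n + 1) / n)
theorem6p10 (suc n') (suc x') _ N!∣x = 1≤α , differs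
  where
  open AlphaSequence n' x'

  1≤α : 1ℚ ℚ.≤ α
  1≤α = fraction-≤⇐ 1 0 A n'
    (subst₂ _≤_ (sym (+-identityʳ N)) (sym (*-identityʳ A)) (≤-trans (m≤m+n N (x' * N)) (m≤m+n (x * N) 1)))

  differs : (c : ℚ → Bool) → IsRealCut c → c 1ℚ ≡ true → c α ≡ false →
    ¬ (∀ i → P c i ≡ P (ratCut α) i)
  differs c _ _ rejects-α same with trans (sym (same-sequence⇒accepts-α N!∣x c same)) rejects-α
  ... | ()
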